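{- Let $\Pi$ be a DatalogMTL$^{FP}$ program and $D$ a database. If for each strongly connected component $C$ of the dependency graph of $\Pi$ there exists a forward propagating repetition pattern for the predicates of $C$ (i.e., there are $T_C\in\mathbb Q$ and $n_C\in\mathbb Q^{>0}$ satisfying the repetition condition below for all predicates $P$ in $C$), then there exists a forward propagating repetition pattern of $\Pi$ (i.e., $T\in\mathbb Q$ and $n\in\mathbb Q^{>0}$ satisfying the condition for all predicates of $\Pi$).
   Context: DatalogMTL over $\mathbb Q$ with continuous semantics. A DatalogMTL$^{FP}$ program is a finite set of rules of the forms $P_1(\boldsymbol\tau_1)\land\dots\land P_n(\boldsymbol\tau_n)\to P_0(\boldsymbol\tau_0)$ ($n\ge0$), $\boxminus_\varrho P_1(\boldsymbol\tau_1)\to P_0(\boldsymbol\tau_0)$ and $\Diamond^-_\varrho P_1(\boldsymbol\tau_1)\to P_0(\boldsymbol\tau_0)$ with non-negative intervals $\varrho$; $\mathfrak M,t\models\boxminus_\varrho A$ iff $A$ holds at all $s$ with $t-s\in\varrho$, and $\mathfrak M,t\models\Diamond^-_\varrho A$ iff $A$ holds at some $s$ with $t-s\in\varrho$. A database is a finite set of facts $A@\varrho$; $\Pi(D)$ is the minimum model, and $P(\boldsymbol\tau)@t\in\Pi(D)$ means the ground atom holds at $t$ in it. Dependency graph: vertices are predicates, an edge $(P,Q)$ for each rule with $P$ in body and $Q$ in head. Repetition condition with parameters $T\in\mathbb Q$, $n\in\mathbb Q^{>0}$ for a predicate $P$: for all $t$ with $T\le t<T+n$, all $x\in\mathbb N$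 and all tuples $\boldsymbol\tau$ of constants, $P(\boldsymbol\tau)@t\in\Pi(D)$ iff $P(\boldsymbol\tau)@(t+n x)\in\Pi(D)$. -}

module Defs where

open import Level using (Level; suc; zero)
open import Data.Nat using (ℕ)
open import Data.Bool using (Bool; true; false)
open import Data.Integer using (+_)
open import Data.Rational using (ℚ; _≤_; _<_; _+_; _-_; _*_; _/_; 0ℚ)
open import Data.List using (List; map; []; _∷_)
open import Data.Empty using (⊥)
open import Data.List.Membership.Propositional using (_∈_)
open import Data.Product using (Σ; ∃; _×_; _,_)
open import Data.Sum using (_⊎_)
open import Data.Unit using (⊤)
open import Relation.Binary.PropositionalEquality using (_≡_)
open import Relation.Binary.Construct.Closure.ReflexiveTransitive using (Star)
open import Function.Bundles using (_⇔_)

Pred : Set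
Pred = ℕ

Const : Set
Const = ℕ

Var : Set
Var = ℕ

data Term : Set where
  var   : Var → Term
  const : Const → Term

record Atom : Set where
  constructor atom
  field
    pred : Pred
    args : List Term

record GroundAtom : Set where
  constructor gatom
  field
    pred : Pred
    args : List Const

-- Interval endpoints over ℚ: infinite, or a rational with a flag
-- telling whether the endpoint is included (true = closed).
data Bound : Set where
  ∞     : Bound
  fin   : ℚ → Bool → Bound

record Interval : Set where
  constructor ⟨_,_⟩
  field
    lower : Bound
    upper : Bound

AboveLower : Bound → ℚ → Set
AboveLower ∞ t = ⊤
AboveLower (fin q true) t = q ≤ t
AboveLower (fin q false) t = q < t

BelowUpper : Bound → ℚ → Set
BelowUpper ∞ t = ⊤
BelowUpper (fin q true) t = t ≤ q
BelowUpper (fin q false) t = t < q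

_∈ᵢ_ : ℚ → Interval → Set
t ∈ᵢ ⟨ l , u ⟩ = AboveLower l t × BelowUpper u t

NonNegInterval : Interval → Set
NonNegInterval ⟨ ∞ , u ⟩ = ⊥
NonNegInterval ⟨ fin q _ , u ⟩ = 0ℚ ≤ q

data Rule : Set where
  -- P₁(τ₁) ∧ … ∧ Pₙ(τₙ) → P₀(τ₀)
  conj : List Atom → Atom → Rule
  -- ⊟_ϱ P₁(τ₁) → P₀(τ₀)
  box  : Interval → Atom → Atom → Rule
  -- ◇⁻_ϱ P₁(τ₁) → P₀(τ₀)
  dia  : Interval → Atom → Atom → Rule

RuleFP : Rule → Set
RuleFP (conj _ _) = ⊤
RuleFP (box ϱ _ _) = NonNegInterval ϱ
RuleFP (dia ϱ _ _) = NonNegInterval ϱ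

Program : Set
Program = List Rule

IsFP : Program → Set
IsFP Π = ∀ {r} → r ∈ Π → RuleFP r

record Fact : Set where
  constructor _at_
  field
    fatom : GroundAtom
    fint  : Interval

Database : Set
Database = List Fact

Interpretation : Set₁
Interpretation = GroundAtom → ℚ → Set

Subst : Set
Subst = Var → Const

applyT : Subst → Term → Const
applyT σ (var v) = σ v
applyT σ (const c) = c

applyA : Subst → Atom → GroundAtom
applyA σ (atom P τ) = gatom P (map (applyT σ) τ)

AllHold : Interpretation → Subst → List Atom → ℚ → Set
AllHold M σ [] t = ⊤
AllHold M σ (A ∷ As) t = M (applyA σ A) t × AllHold M σ As t

BodyHolds : Interpretation → Subst → Rule → ℚ → Set
BodyHolds M σ (conj Bs _) t = AllHold M σ Bs t
BodyHolds M σ (box ϱ B _) t = ∀ s → (t - s) ∈ᵢ ϱ → M (applyA σ B) s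
BodyHolds M σ (dia ϱ B _) t = ∃ λ s → (t - s) ∈ᵢ ϱ × M (applyA σ B) s

headOf : Rule → Atom
headOf (conj _ H) = H
headOf (box _ _ H) = H
headOf (dia _ _ H) = H

SatRule : Interpretation → Rule → Set
SatRule M r = ∀ (σ : Subst) (t : ℚ) → BodyHolds M σ r t → M (applyA σ (headOf r)) t

SatFact : Interpretation → Fact → Set
SatFact M (A at ϱ) = ∀ t → t ∈ᵢ ϱ → M A t

IsModel : Program → Database → Interpretation → Set
IsModel Π D M = (∀ {r} → r ∈ Π → SatRule M r) × (∀ {f} → f ∈ D → SatFact M f)

-- A@t ∈ Π(D): A holds at t in the minimum model of Π and D, i.e. in the
-- intersection of all models of Π and D.
_holdsAt_∈Min_,_ : GroundAtom → ℚ → Program → Database → Set₁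
A holdsAt t ∈Min Π , D = ∀ (M : Interpretation) → IsModel Π D M → M A t

bodyPreds : Rule → List Pred
bodyPreds (conj Bs _) = map Atom.pred Bs
bodyPreds (box _ B _) = Atom.pred B ∷ []
bodyPreds (dia _ B _) = Atom.pred B ∷ []

Edge : Program → Pred → Pred → Set
Edge Π P Q = ∃ λ r → r ∈ Π × P ∈ bodyPreds r × Q ≡ Atom.pred (headOf r)

PredOf : Program → Pred → Set
PredOf Π P = ∃ λ r → r ∈ Π × (P ∈ bodyPreds r ⊎ P ≡ Atom.pred (headOf r))

Reach : Program → Pred → Pred → Set
Reach Π = Star (Edge Π)

SameSCC : Program → Pred → Pred → Set
SameSCC Π P Q = Reach Π P Q × Reach Π Q P

ℕtoℚ : ℕ → ℚ
ℕtoℚ x = + x / 1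

Repeats : Program → Database → ℚ → ℚ → Pred → Set₁
Repeats Π D T n P =
  ∀ (t : ℚ) → T ≤ t → t < T + n → ∀ (x : ℕ) (τ : List Const) →
    (gatom P τ holdsAt t ∈Min Π , D) ⇔ (gatom P τ holdsAt (t + n * ℕtoℚ x) ∈Min Π , D)

{-# OPTIONS --safe #-}
module Submission where

open import Defs
open import Data.Nat as ℕ using (zero; suc)
import Data.Nat.Properties as ℕ
open import Data.Nat.Coprimality using (Coprime; 1-coprimeTo)
import Data.Nat.Coprimality as Coprime
open import Data.Integer as ℤ using (+_)
import Data.Integer.Properties as ℤ
import Data.Rational.Unnormalised.Base as ℚᵘ using (*≡*)
import Data.Rational.Unnormalised.Properties as ℚᵘ using (≃-trans)
open import Data.Rational
open import Data.Rational.Properties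
open import Data.Rational.Solver using (module +-*-Solver)
open import Data.List using (List; []; _∷_; _++_)
open import Data.List.Membership.Propositional using (_∈_)
open import Data.List.Membership.Propositional.Properties using (∈-++⁺ˡ; ∈-++⁺ʳ; ∈-++⁻)
open import Data.List.Relation.Unary.Any using (here; there)
open import Data.Product using (Σ; ∃; ∃₂; _×_; _,_)
open import Data.Sum using (inj₁; inj₂)
open import Data.Empty using (⊥-elim)
open import Function.Base using (_∘_)
open import Function.Bundles using (_⇔_)
import Function.Properties.Equivalence as ⇔
open import Level using (Level)
open import Relation.Nullary using (yes; no)
open import Relation.Binary.PropositionalEquality
open import Relation.Binary.Construct.Closure.ReflexiveTransitive using (ε)
open +-*-Solver

-- Each predicate P lies in some strongly connected component, so it has a pattern (T_P, n_P)
-- of its own.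
-- A repetition on the window [T_P, T_P + n_P) propagates to the whole ray t ≥ T_P, and such
-- eventual periodicity survives raising T_P and multiplying n_P by a natural number.  Scaling
-- n_P by its denominator makes it an integer, so for the finitely many predicates of Π the
-- maximum of the T_P together with the product of these integers is a common pattern.

private
  variable
    ℓ : Level

ℕtoℚ-mkℚ : ∀ k → ℕtoℚ k ≡ mkℚ (+ k) 0 (Coprime.sym (1-coprimeTo k))
ℕtoℚ-mkℚ k = normalize-coprime (Coprime.sym (1-coprimeTo k))

ℕtoℚ-+ : ∀ a b → ℕtoℚ (a ℕ.+ b) ≡ ℕtoℚ a + ℕtoℚ b
ℕtoℚ-+ a b rewrite ℕtoℚ-mkℚ a | ℕtoℚ-mkℚ b =
  cong (_/ 1) (trans (ℤ.pos-+ a b) (sym (cong₂ ℤ._+_ (ℤ.*-identityʳ (+ a)) (ℤ.*-identityʳ (+ b)))))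

ℕtoℚ-* : ∀ a b → ℕtoℚ (a ℕ.* b) ≡ ℕtoℚ a * ℕtoℚ b
ℕtoℚ-* a b rewrite ℕtoℚ-mkℚ a | ℕtoℚ-mkℚ b = cong (_/ 1) (ℤ.pos-* a b)

ℕtoℚ-mono-≤ : ∀ {a b} → a ℕ.≤ b → ℕtoℚ a ≤ ℕtoℚ b
ℕtoℚ-mono-≤ {a} {b} a≤b rewrite ℕtoℚ-mkℚ a | ℕtoℚ-mkℚ b =
  *≤* (subst₂ ℤ._≤_ (sym (ℤ.*-identityʳ _)) (sym (ℤ.*-identityʳ _)) (ℤ.+≤+ a≤b))

ℕtoℚ-mono-< : ∀ {a b} → a ℕ.< b → ℕtoℚ a < ℕtoℚ b
ℕtoℚ-mono-< {a} {b} a<b rewrite ℕtoℚ-mkℚ a | ℕtoℚ-mkℚ b =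
  *<* (subst₂ ℤ._<_ (sym (ℤ.*-identityʳ _)) (sym (ℤ.*-identityʳ _)) (ℤ.+<+ a<b))

ℕtoℚ-nonNeg : ∀ k → 0ℚ ≤ ℕtoℚ k
ℕtoℚ-nonNeg k = ℕtoℚ-mono-≤ {0} {k} ℕ.z≤n

1≤ℕtoℚ-suc : ∀ k → 1ℚ ≤ ℕtoℚ (suc k)
1≤ℕtoℚ-suc k = ℕtoℚ-mono-≤ {1} {suc k} (ℕ.s≤s ℕ.z≤n)

*-denominator≡numerator : ∀ c b .(c⊥b : Coprime c (suc b)) → mkℚ (+ c) b c⊥b * ℕtoℚ (suc b) ≡ ℕtoℚ c
*-denominator≡numerator c b c⊥b rewrite ℕtoℚ-mkℚ (suc b) | ℕtoℚ-mkℚ c =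
  toℚᵘ-injective (ℚᵘ.≃-trans (toℚᵘ-homo-* (mkℚ (+ c) b c⊥b) (mkℚ (+ suc b) 0 (Coprime.sym (1-coprimeTo (suc b)))))
    (ℚᵘ.*≡* (trans (ℤ.*-identityʳ _) (cong (+ c ℤ.*_) (sym (ℤ.*-identityʳ _))))))

p≤p*q : ∀ {p q} → 0ℚ ≤ p → 1ℚ ≤ q → p ≤ p * q
p≤p*q {p} {q} 0≤p 1≤q = subst (_≤ p * q) (*-identityʳ p) (*-monoˡ-≤-nonNeg p {{nonNegative 0≤p}} 1≤q)

-<⇒<+ : ∀ {p q r} → p - q < r → p < q + r
-<⇒<+ {p} {q} {r} p-q<r =
  subst₂ _<_ (solve 2 (λ p q → p :- q :+ q := p) refl p q) (+-comm r q) (+-monoˡ-< q p-q<r)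

archimedean : ∀ d n → 0ℚ < n → ∃ λ k → d < ℕtoℚ k * n
archimedean d@(mkℚ ℤ.-[1+ _ ] _ _) n _ = 0 , subst (d <_) (sym (*-zeroˡ n)) (negative⁻¹ d)
archimedean d (mkℚ ℤ.-[1+ _ ] _ _) n>0 = ⊥-elim (<-asym n>0 (negative⁻¹ _))
archimedean d (mkℚ (+ zero) _ _) (*<* (ℤ.+<+ ()))
archimedean d@(mkℚ (+ p) e d-coprime) n@(mkℚ (+ suc c) b n-coprime) _ = suc p ℕ.* suc b , (begin-strict
  d                                  ≤⟨ p≤p*q (nonNegative⁻¹ d) (1≤ℕtoℚ-suc e) ⟩
  d * ℕtoℚ (suc e)                   ≡⟨ *-denominator≡numerator p e d-coprime ⟩
  ℕtoℚ p                             <⟨ ℕtoℚ-mono-< (ℕ.n<1+n p) ⟩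
  ℕtoℚ (suc p)                       ≤⟨ p≤p*q (ℕtoℚ-nonNeg (suc p)) (1≤ℕtoℚ-suc c) ⟩
  ℕtoℚ (suc p) * ℕtoℚ (suc c)        ≡⟨ cong (ℕtoℚ (suc p) *_) (sym (*-denominator≡numerator (suc c) b n-coprime)) ⟩
  ℕtoℚ (suc p) * (n * ℕtoℚ (suc b))  ≡⟨ solve 3 (λ x y z → x :* (z :* y) := (x :* y) :* z) refl (ℕtoℚ (suc p)) (ℕtoℚ (suc b)) n ⟩
  ℕtoℚ (suc p) * ℕtoℚ (suc b) * n    ≡⟨ cong (_* n) (sym (ℕtoℚ-* (suc p) (suc b))) ⟩
  ℕtoℚ (suc p ℕ.* suc b) * n         ∎)
  where open ≤-Reasoning

module _ {I : Set} (F : I → ℚ → Set ℓ) where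

  PeriodicFrom : ℚ → ℚ → Set ℓ
  PeriodicFrom T n = ∀ i t → T ≤ t → ∀ x → F i t ⇔ F i (t + n * ℕtoℚ x)

  PeriodicOnWindow : ℚ → ℚ → Set ℓ
  PeriodicOnWindow T n = ∀ i t → T ≤ t → t < T + n → ∀ x → F i t ⇔ F i (t + n * ℕtoℚ x)

  -- Induction on the number k of periods within which t lies beyond T: a point t ≥ T + n
  -- is one period past t - n, whose orbit, t included, is known by induction.
  periodicOnWindow⇒periodicFrom : ∀ {T n} → 0ℚ < n → PeriodicOnWindow T n → PeriodicFrom T n
  periodicOnWindow⇒periodicFrom {T} {n} n>0 window i t T≤t with archimedean (t - T) n n>0
  ... | k , t-T<kn = below k t T≤t (-<⇒<+ {t} {T} {ℕtoℚ k * n} t-T<kn)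
    where
    below : ∀ k t → T ≤ t → t < T + ℕtoℚ k * n → ∀ x → F i t ⇔ F i (t + n * ℕtoℚ x)
    below zero t T≤t t<T+0 =
      ⊥-elim (<-irrefl refl (≤-<-trans T≤t (subst (t <_) (trans (cong (λ q → T + q) (*-zeroˡ n)) (+-identityʳ T)) t<T+0)))
    below (suc k) t T≤t t<T+[k+1]n x with t <? T + n
    ... | yes t<T+n = window i t T≤t t<T+n x
    ... | no t≮T+n =
      ⇔.trans (⇔.sym (subst (F i (t - n) ⇔_) (cong (F i) back) (previous 1)))
              (subst (F i (t - n) ⇔_) (cong (F i) forth) (previous (suc x)))
      where
      T≤t-n : T ≤ t - n
      T≤t-n = subst (_≤ t - n) (solve 2 (λ T n → T :+ n :- n := T) refl T n) (+-monoˡ-≤ (- n) (≮⇒≥ t≮T+n))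
      t-n<T+kn : t - n < T + ℕtoℚ k * n
      t-n<T+kn = subst (t - n <_)
        (trans (cong (λ m → T + m * n - n) (ℕtoℚ-+ 1 k)) (solve 3 (λ T m n → T :+ (con 1ℚ :+ m) :* n :- n := T :+ m :* n) refl T (ℕtoℚ k) n))
        (+-monoˡ-< (- n) t<T+[k+1]n)
      previous : ∀ y → F i (t - n) ⇔ F i (t - n + n * ℕtoℚ y)
      previous = below k (t - n) T≤t-n t-n<T+kn
      back : t - n + n * ℕtoℚ 1 ≡ t
      back = solve 2 (λ t n → t :- n :+ n :* con 1ℚ := t) refl t n
      forth : t - n + n * ℕtoℚ (suc x) ≡ t + n * ℕtoℚ x
      forth = trans (cong (λ m → t - n + n * m) (ℕtoℚ-+ 1 x))
                    (solve 3 (λ t n m → t :- n :+ n :* (con 1ℚ :+ m) := t :+ n :* m) refl t n (ℕtoℚ x))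

  periodicFrom-≤ : ∀ {T T′ n} → T ≤ T′ → PeriodicFrom T n → PeriodicFrom T′ n
  periodicFrom-≤ T≤T′ periodic i t T′≤t = periodic i t (≤-trans T≤T′ T′≤t)

  periodicFrom-* : ∀ {T n} m → PeriodicFrom T n → PeriodicFrom T (n * ℕtoℚ m)
  periodicFrom-* {T} {n} m periodic i t T≤t x =
    subst (λ s → F i t ⇔ F i (t + s)) (trans (cong (n *_) (ℕtoℚ-* m x)) (sym (*-assoc n _ _))) (periodic i t T≤t (m ℕ.* x))

  periodicFrom-ℕ-* : ∀ {T} M K → PeriodicFrom T (ℕtoℚ M) → PeriodicFrom T (ℕtoℚ (M ℕ.* K))
  periodicFrom-ℕ-* {T} M K periodic = subst (PeriodicFrom T) (sym (ℕtoℚ-* M K)) (periodicFrom-* {T} {ℕtoℚ M} K periodic)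

  periodicFrom-ℕ : ∀ {T n} → 0ℚ < n → PeriodicFrom T n → ∃ λ N → PeriodicFrom T (ℕtoℚ (suc N))
  periodicFrom-ℕ {n = mkℚ ℤ.-[1+ _ ] _ _} n>0 _ = ⊥-elim (<-asym n>0 (negative⁻¹ _))
  periodicFrom-ℕ {n = mkℚ (+ zero) _ _} (*<* (ℤ.+<+ ())) _
  periodicFrom-ℕ {T} {mkℚ (+ suc c) b n-coprime} _ periodic =
    c , subst (PeriodicFrom T) (*-denominator≡numerator (suc c) b n-coprime) (periodicFrom-* {T} {mkℚ (+ suc c) b n-coprime} (suc b) periodic)

commonPeriod : ∀ {A I : Set} (F : A → I → ℚ → Set ℓ) (L : List A) →
  (∀ a → a ∈ L → ∃₂ λ T N → PeriodicFrom (F a) T (ℕtoℚ (suc N))) →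
  ∃₂ λ T N → ∀ a → a ∈ L → PeriodicFrom (F a) T (ℕtoℚ (suc N))
commonPeriod F [] _ = 0ℚ , 0 , λ _ ()
commonPeriod F (a ∷ L) periodic
  with periodic a (here refl) | commonPeriod F L (λ b b∈L → periodic b (there b∈L))
... | T₁ , M , periodic-a | T₂ , N , periodic-L = T₁ ⊔ T₂ , N ℕ.+ M ℕ.* suc N , λ where
  b (here refl) → periodicFrom-≤ (F a) {T₁} {T₁ ⊔ T₂} {ℕtoℚ (suc M ℕ.* suc N)} (p≤p⊔q T₁ T₂)
    (periodicFrom-ℕ-* (F a) {T₁} (suc M) (suc N) periodic-a)
  b (there b∈L) → periodicFrom-≤ (F b) {T₂} {T₁ ⊔ T₂} {ℕtoℚ (suc M ℕ.* suc N)} (p≤q⊔p T₁ T₂)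
    (subst (PeriodicFrom (F b) T₂ ∘ ℕtoℚ) (ℕ.*-comm (suc N) (suc M))
      (periodicFrom-ℕ-* (F b) {T₂} (suc N) (suc M) (periodic-L b b∈L)))

predicates : Program → List Pred
predicates [] = []
predicates (r ∷ Π) = (Atom.pred (headOf r) ∷ bodyPreds r) ++ predicates Π

PredOf⇒∈predicates : ∀ {Π P} → PredOf Π P → P ∈ predicates Π
PredOf⇒∈predicates {r ∷ Π} (r , here refl , inj₁ P∈body) = ∈-++⁺ˡ {ys = predicates Π} (there P∈body)
PredOf⇒∈predicates {r ∷ Π} (r , here refl , inj₂ refl) = ∈-++⁺ˡ {ys = predicates Π} (here refl)
PredOf⇒∈predicates {r′ ∷ Π} (r , there r∈Π , P∈r) = ∈-++⁺ʳ (Atom.pred (headOf r′) ∷ bodyPreds r′) (PredOf⇒∈predicates (r , r∈Π , P∈r))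

∈predicates⇒PredOf : ∀ Π {P} → P ∈ predicates Π → PredOf Π P
∈predicates⇒PredOf (r ∷ Π) P∈ with ∈-++⁻ (Atom.pred (headOf r) ∷ bodyPreds r) P∈
... | inj₁ (here refl) = r , here refl , inj₂ refl
... | inj₁ (there P∈body) = r , here refl , inj₁ P∈body
... | inj₂ P∈Π with ∈predicates⇒PredOf Π P∈Π
...   | r′ , r′∈Π , P∈r′ = r′ , there r′∈Π , P∈r′

lemma1 : (Π : Program) → IsFP Π → (D : Database) →
    (∀ C → PredOf Π C → Σ ℚ λ T → Σ ℚ λ n → 0ℚ < n ×
       (∀ P → PredOf Π P → SameSCC Π C P → Repeats Π D T n P)) →
    Σ ℚ λ T → Σ ℚ λ n → 0ℚ < n × (∀ P → PredOf Π P → Repeats Π D T n P)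
lemma1 Π _ D repeats =
  let T , N , periodic = commonPeriod Holds (predicates Π) eventuallyPeriodic
  in T , ℕtoℚ (suc N) , ℕtoℚ-mono-< {0} {suc N} (ℕ.s≤s ℕ.z≤n) ,
     λ P P∈Π t T≤t _ x τ → periodic P (PredOf⇒∈predicates P∈Π) τ t T≤t x
  where
  Holds : Pred → List Const → ℚ → Set₁
  Holds P τ t = gatom P τ holdsAt t ∈Min Π , D

  eventuallyPeriodic : ∀ P → P ∈ predicates Π → ∃₂ λ T N → PeriodicFrom (Holds P) T (ℕtoℚ (suc N))
  eventuallyPeriodic P P∈Π with repeats P (∈predicates⇒PredOf Π P∈Π)
  ... | T , n , n>0 , repeats-SCC = T , periodicFrom-ℕ (Holds P) n>0
    (periodicOnWindow⇒periodicFrom (Holds P) n>0 λ τ t T≤t t<T+n x →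
      repeats-SCC P (∈predicates⇒PredOf Π P∈Π) (ε , ε) t T≤t t<T+n x τ)
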